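{- Let $\mathbf{TSMC}$ be the category of traced symmetric strict monoidal categories and trace-preserving strict symmetric monoidal functors, and $\mathbf{UTSMC}$ its full subcategory of uniformly traced ones. The assignment $\mathcal{C}\mapsto\mathrm{Unif}(\mathcal{C})$, extended to morphisms $F\colon\mathcal{B}\to\mathcal{C}$ by $\mathrm{Unif}(F)(X)=F(X)$ and $\mathrm{Unif}(F)[f]=[F f]$, is a functor $\mathbf{TSMC}\to\mathbf{UTSMC}$ that is left adjoint to the inclusion functor $\mathbf{UTSMC}\to\mathbf{TSMC}$.
   Context: Composition is diagrammatic ($f;g$ = first $f$ then $g$). A traced symmetric strict monoidal category is a symmetric strict monoidal category $(\mathcal{C},\otimes,I,\sigma)$ with operators $\mathsf{tr}_S\colon\mathcal{C}(S\otimes X,S\otimes Y)\to\mathcal{C}(X,Y)$ satisfying tightening $\mathsf{tr}_S((\mathrm{id}\otimes u);f;(\mathrm{id}\otimes v))=u;\mathsf{tr}_S f;v$, strength $\mathsf{tr}_S(f\otimes g)=\mathsf{tr}_S f\otimes g$, joining $\mathsf{tr}_T\mathsf{tr}_S f=\mathsf{tr}_{S\otimes T}f$, vanishing $\mathsf{tr}_I f=f$, sliding $\mathsf{tr}_T(f;(u\otimes\mathrm{id}))=\mathsf{tr}_S((u\otimes\mathrm{id});f)$, yanking $\mathsf{tr}_S\sigma_{S,S}=\mathrm{id}_S$. It is uniformly traced if, whenever $f\colon S\otimes X\to S\otimes Y$, $g\colon T\otimes X\to T\otimes Y$, $r\colon S\to T$ satisfy $f;(r\otimes\mathrm{id}_Y)=(r\otimes\mathrm{id}_X);g$,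 one has $\mathsf{tr}_Sf=\mathsf{tr}_Tg$. For a traced category $\mathcal{C}$, $\approx_{\mathcal{C}}$ is the smallest relation on parallel morphisms that is reflexive, symmetric, transitive, closed under $;$ and $\otimes$, and such that $u\approx v$ ($u,v\colon S\to T$) and $f;(u\otimes\mathrm{id}_Y)\approx(v\otimes\mathrm{id}_X);g$ imply $\mathsf{tr}_Sf\approx\mathsf{tr}_Tg$. $\mathrm{Unif}(\mathcal{C})$ has the objects of $\mathcal{C}$, morphisms the $\approx_{\mathcal{C}}$-classes $[f]$, and composition, $\otimes$, symmetries and trace induced from $\mathcal{C}$ (these are well defined and make it uniformly traced). -}

module Defs where

open import Level using (Level; _⊔_) renaming (suc to lsuc)
open import Relation.Binary.PropositionalEquality as P using (_≡_; refl; subst; cong)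
open import Relation.Binary using (Rel; IsEquivalence)
open import Data.Product using (Σ; _×_; _,_; Σ-syntax)

-- Categories whose hom-sets carry an equality (setoid-enriched),
-- with objects, morphisms and morphism equality all in one universe ℓ.
-- Composition is diagrammatic:  f ⨾ g  = "first f, then g".

record Category (ℓ : Level) : Set (lsuc ℓ) where
  infix  4 _≈_
  infixr 9 _⨾_
  field
    Obj       : Set ℓ
    Hom       : Obj → Obj → Set ℓ
    _≈_       : ∀ {A B} → Rel (Hom A B) ℓ
    ≈-equiv   : ∀ {A B} → IsEquivalence (_≈_ {A} {B})
    id        : ∀ {A} → Hom A A
    _⨾_       : ∀ {A B C} → Hom A B → Hom B C → Hom A C
    ⨾-cong    : ∀ {A B C} {f f' : Hom A B} {g g' : Hom B C} →
                f ≈ f' → g ≈ g' → f ⨾ g ≈ f' ⨾ g'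
    identityˡ : ∀ {A B} {f : Hom A B} → id ⨾ f ≈ f
    identityʳ : ∀ {A B} {f : Hom A B} → f ⨾ id ≈ f
    assoc     : ∀ {A B C D} {f : Hom A B} {g : Hom B C} {h : Hom C D} →
                (f ⨾ g) ⨾ h ≈ f ⨾ (g ⨾ h)

  -- the identity morphism transported along an equality of objects
  -- (needed to state the laws of *strict* monoidal structure)
  cast : ∀ {A B} → A ≡ B → Hom A B
  cast {A} p = subst (Hom A) p id

  ≈-refl : ∀ {A B} {f : Hom A B} → f ≈ f
  ≈-refl = IsEquivalence.refl ≈-equiv
  ≈-sym : ∀ {A B} {f g : Hom A B} → f ≈ g → g ≈ f
  ≈-sym = IsEquivalence.sym ≈-equiv
  ≈-trans : ∀ {A B} {f g h : Hom A B} → f ≈ g → g ≈ h → f ≈ h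
  ≈-trans = IsEquivalence.trans ≈-equiv

record TSMC (ℓ : Level) : Set (lsuc ℓ) where
  field
    category : Category ℓ
  open Category category public
  infixr 10 _⊗₀_ _⊗₁_
  field
    I        : Obj
    _⊗₀_     : Obj → Obj → Obj
    ⊗₀-assoc : ∀ A B C → (A ⊗₀ B) ⊗₀ C ≡ A ⊗₀ (B ⊗₀ C)
    ⊗₀-unitˡ : ∀ A → I ⊗₀ A ≡ A
    ⊗₀-unitʳ : ∀ A → A ⊗₀ I ≡ A
    _⊗₁_     : ∀ {A B C D} → Hom A B → Hom C D → Hom (A ⊗₀ C) (B ⊗₀ D)
    ⊗₁-cong  : ∀ {A B C D} {f f' : Hom A B} {g g' : Hom C D} →
               f ≈ f' → g ≈ g' → f ⊗₁ g ≈ f' ⊗₁ g'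
    ⊗-id     : ∀ {A B} → id {A} ⊗₁ id {B} ≈ id
    ⊗-⨾      : ∀ {A B C D E F} {f : Hom A B} {g : Hom B C} {h : Hom D E} {k : Hom E F} →
               (f ⨾ g) ⊗₁ (h ⨾ k) ≈ (f ⊗₁ h) ⨾ (g ⊗₁ k)
    ⊗-assoc  : ∀ {A B C D E F} {f : Hom A B} {g : Hom C D} {h : Hom E F} →
               cast (P.sym (⊗₀-assoc A C E)) ⨾ ((f ⊗₁ g) ⊗₁ h) ⨾ cast (⊗₀-assoc B D F)
                 ≈ f ⊗₁ (g ⊗₁ h)
    ⊗-unitˡ  : ∀ {A B} {f : Hom A B} →
               cast (P.sym (⊗₀-unitˡ A)) ⨾ (id {I} ⊗₁ f) ⨾ cast (⊗₀-unitˡ B) ≈ f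
    ⊗-unitʳ  : ∀ {A B} {f : Hom A B} →
               cast (P.sym (⊗₀-unitʳ A)) ⨾ (f ⊗₁ id {I}) ⨾ cast (⊗₀-unitʳ B) ≈ f
    σ            : ∀ A B → Hom (A ⊗₀ B) (B ⊗₀ A)
    σ-natural    : ∀ {A B C D} {f : Hom A B} {g : Hom C D} →
                   (f ⊗₁ g) ⨾ σ B D ≈ σ A C ⨾ (g ⊗₁ f)
    σ-involutive : ∀ A B → σ A B ⨾ σ B A ≈ id
    σ-hexagon    : ∀ A B C →
                   σ A (B ⊗₀ C) ≈ cast (P.sym (⊗₀-assoc A B C)) ⨾ (σ A B ⊗₁ id {C})
                                   ⨾ cast (⊗₀-assoc B A C) ⨾ (id {B} ⊗₁ σ A C)
                                   ⨾ cast (P.sym (⊗₀-assoc B C A))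
    tr         : ∀ S {X Y} → Hom (S ⊗₀ X) (S ⊗₀ Y) → Hom X Y
    tr-cong    : ∀ {S X Y} {f g : Hom (S ⊗₀ X) (S ⊗₀ Y)} → f ≈ g → tr S f ≈ tr S g
    tightening : ∀ {S X X' Y Y'} (u : Hom X' X) (f : Hom (S ⊗₀ X) (S ⊗₀ Y)) (v : Hom Y Y') →
                 tr S ((id ⊗₁ u) ⨾ f ⨾ (id ⊗₁ v)) ≈ u ⨾ tr S f ⨾ v
    strength   : ∀ {S X Y Z W} (f : Hom (S ⊗₀ X) (S ⊗₀ Y)) (g : Hom Z W) →
                 tr S (cast (P.sym (⊗₀-assoc S X Z)) ⨾ (f ⊗₁ g) ⨾ cast (⊗₀-assoc S Y W))
                   ≈ tr S f ⊗₁ g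
    joining    : ∀ {S T X Y} (f : Hom (S ⊗₀ (T ⊗₀ X)) (S ⊗₀ (T ⊗₀ Y))) →
                 tr T (tr S f)
                   ≈ tr (S ⊗₀ T) (cast (⊗₀-assoc S T X) ⨾ f ⨾ cast (P.sym (⊗₀-assoc S T Y)))
    vanishing  : ∀ {X Y} (f : Hom (I ⊗₀ X) (I ⊗₀ Y)) →
                 tr I f ≈ cast (P.sym (⊗₀-unitˡ X)) ⨾ f ⨾ cast (⊗₀-unitˡ Y)
    sliding    : ∀ {S T X Y} (f : Hom (T ⊗₀ X) (S ⊗₀ Y)) (u : Hom S T) →
                 tr T (f ⨾ (u ⊗₁ id)) ≈ tr S ((u ⊗₁ id) ⨾ f)
    yanking    : ∀ S → tr S (σ S S) ≈ id

IsUniform : ∀ {ℓ} → TSMC ℓ → Set ℓ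
IsUniform C =
  ∀ {S T X Y} (f : Hom (S ⊗₀ X) (S ⊗₀ Y)) (g : Hom (T ⊗₀ X) (T ⊗₀ Y)) (r : Hom S T) →
  f ⨾ (r ⊗₁ id) ≈ (r ⊗₁ id) ⨾ g → tr S f ≈ tr T g
  where open TSMC C

record UTSMC (ℓ : Level) : Set (lsuc ℓ) where
  field
    tsmc    : TSMC ℓ
    uniform : IsUniform tsmc

ι : ∀ {ℓ} → UTSMC ℓ → TSMC ℓ
ι = UTSMC.tsmc

record _⇒_ {ℓ} (C D : TSMC ℓ) : Set ℓ where
  private
    module C = TSMC C
    module D = TSMC D
  field
    F₀     : C.Obj → D.Obj
    F₁     : ∀ {A B} → C.Hom A B → D.Hom (F₀ A) (F₀ B)
    F-cong : ∀ {A B} {f g : C.Hom A B} → f C.≈ g → F₁ f D.≈ F₁ g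
    F-id   : ∀ {A} → F₁ (C.id {A}) D.≈ D.id
    F-⨾    : ∀ {A B E} {f : C.Hom A B} {g : C.Hom B E} → F₁ (f C.⨾ g) D.≈ F₁ f D.⨾ F₁ g
    F-I    : F₀ C.I ≡ D.I
    F-⊗₀   : ∀ A B → F₀ (A C.⊗₀ B) ≡ F₀ A D.⊗₀ F₀ B
    F-⊗₁   : ∀ {A B A' B'} {f : C.Hom A B} {g : C.Hom A' B'} →
             F₁ (f C.⊗₁ g) D.≈ D.cast (F-⊗₀ A A') D.⨾ (F₁ f D.⊗₁ F₁ g) D.⨾ D.cast (P.sym (F-⊗₀ B B'))
    F-σ    : ∀ A B →
             F₁ (C.σ A B) D.≈ D.cast (F-⊗₀ A B) D.⨾ D.σ (F₀ A) (F₀ B) D.⨾ D.cast (P.sym (F-⊗₀ B A))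
    F-tr   : ∀ S {X Y} (f : C.Hom (S C.⊗₀ X) (S C.⊗₀ Y)) →
             F₁ (C.tr S f) D.≈ D.tr (F₀ S) (D.cast (P.sym (F-⊗₀ S X)) D.⨾ F₁ f D.⨾ D.cast (F-⊗₀ S Y))
open _⇒_ public

-- equality of morphisms of TSMC (equality of functors between strict categories):
-- equal on objects, and on morphisms up to the induced transport.
infix 4 _≐_
record _≐_ {ℓ} {C D : TSMC ℓ} (F G : C ⇒ D) : Set ℓ where
  private
    module C = TSMC C
    module D = TSMC D
  field
    eq₀ : ∀ A → F₀ F A ≡ F₀ G A
    eq₁ : ∀ {A B} (f : C.Hom A B) →
          D.cast (P.sym (eq₀ A)) D.⨾ F₁ F f D.⨾ D.cast (eq₀ B) D.≈ F₁ G f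

idF : ∀ {ℓ} {C : TSMC ℓ} → C ⇒ C
idF {C = C} = record
  { F₀ = λ A → A ; F₁ = λ f → f ; F-cong = λ p → p ; F-id = ≈-refl ; F-⨾ = ≈-refl
  ; F-I = refl ; F-⊗₀ = λ _ _ → refl
  ; F-⊗₁ = ≈-sym idid ; F-σ = λ _ _ → ≈-sym idid ; F-tr = λ _ _ → tr-cong (≈-sym idid) }
  where
  open TSMC C
  idid : ∀ {A B} {f : Hom A B} → id ⨾ f ⨾ id ≈ f
  idid = ≈-trans identityˡ identityʳ

private
  module CompLemmas {ℓ} {B C : TSMC ℓ} (G : B ⇒ C) where
    module B = TSMC B
    module C = TSMC C
    idid : ∀ {A A'} {f : C.Hom A A'} → C.id C.⨾ f C.⨾ C.id C.≈ f
    idid = C.≈-trans C.identityˡ C.identityʳ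
    bidid : ∀ {A A'} {f : B.Hom A A'} → B.id B.⨾ f B.⨾ B.id B.≈ f
    bidid = B.≈-trans B.identityˡ B.identityʳ

    lem₁ : ∀ {X X' Y Y' : B.Obj} {Z W : C.Obj}
           (p : X ≡ X') (p' : Y ≡ Y') (q : F₀ G X' ≡ Z) (q' : F₀ G Y' ≡ W)
           (h : B.Hom X' Y') (H : C.Hom Z W) →
           F₁ G h C.≈ C.cast q C.⨾ H C.⨾ C.cast (P.sym q') →
           F₁ G (B.cast p B.⨾ h B.⨾ B.cast (P.sym p'))
             C.≈ C.cast (P.trans (cong (F₀ G) p) q) C.⨾ H C.⨾ C.cast (P.sym (P.trans (cong (F₀ G) p') q'))
    lem₁ refl refl refl refl h H e = C.≈-trans (F-cong G bidid) e

    lem₂ : ∀ {K K' L L' : B.Obj} {M N : C.Obj}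
           (p : K ≡ K') (p' : L ≡ L') (q : F₀ G K' ≡ M) (q' : F₀ G L' ≡ N) (k : B.Hom K L) →
           C.cast (P.sym q) C.⨾ F₁ G (B.cast (P.sym p) B.⨾ k B.⨾ B.cast p') C.⨾ C.cast q'
             C.≈ C.cast (P.sym (P.trans (cong (F₀ G) p) q)) C.⨾ F₁ G k C.⨾ C.cast (P.trans (cong (F₀ G) p') q')
    lem₂ refl refl refl refl k = C.⨾-cong C.≈-refl (C.⨾-cong (F-cong G bidid) C.≈-refl)

infixr 9 _⨾F_
_⨾F_ : ∀ {ℓ} {A B C : TSMC ℓ} → A ⇒ B → B ⇒ C → A ⇒ C
_⨾F_ {A = A} {B} {C} F G = record
  { F₀ = λ X → F₀ G (F₀ F X)
  ; F₁ = λ f → F₁ G (F₁ F f)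
  ; F-cong = λ e → F-cong G (F-cong F e)
  ; F-id = C.≈-trans (F-cong G (F-id F)) (F-id G)
  ; F-⨾ = C.≈-trans (F-cong G (F-⨾ F)) (F-⨾ G)
  ; F-I = P.trans (cong (F₀ G) (F-I F)) (F-I G)
  ; F-⊗₀ = F⊗₀
  ; F-⊗₁ = C.≈-trans (F-cong G (F-⊗₁ F))
             (L.lem₁ (F-⊗₀ F _ _) (F-⊗₀ F _ _) (F-⊗₀ G _ _) (F-⊗₀ G _ _) _ _ (F-⊗₁ G))
  ; F-σ = λ X Y → C.≈-trans (F-cong G (F-σ F X Y))
             (L.lem₁ (F-⊗₀ F _ _) (F-⊗₀ F _ _) (F-⊗₀ G _ _) (F-⊗₀ G _ _) _ _ (F-σ G _ _))
  ; F-tr = λ S f → C.≈-trans (F-cong G (F-tr F S f))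
             (C.≈-trans (F-tr G _ _)
               (C.tr-cong (L.lem₂ (F-⊗₀ F _ _) (F-⊗₀ F _ _) (F-⊗₀ G _ _) (F-⊗₀ G _ _) _)))
  }
  where
  module A = TSMC A
  module C = TSMC C
  module L = CompLemmas G
  F⊗₀ : ∀ X Y → F₀ G (F₀ F (X A.⊗₀ Y)) ≡ F₀ G (F₀ F X) C.⊗₀ F₀ G (F₀ F Y)
  F⊗₀ X Y = P.trans (cong (F₀ G) (F-⊗₀ F X Y)) (F-⊗₀ G _ _)

-- The relation ≈_C (written _∼_ here) and the traced category Unif(C).
-- _∼_ is the smallest relation on parallel morphisms containing the
-- equality of C (this is "reflexive"), symmetric, transitive, closed under
-- ⨾ and ⊗, and closed under the uniformity rule for the trace.

module _ {ℓ} (C : TSMC ℓ) where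
  open TSMC C

  infix 4 _∼_
  data _∼_ : ∀ {A B} → Hom A B → Hom A B → Set ℓ where
    base    : ∀ {A B} {f g : Hom A B} → f ≈ g → f ∼ g
    ∼-sym   : ∀ {A B} {f g : Hom A B} → f ∼ g → g ∼ f
    ∼-trans : ∀ {A B} {f g h : Hom A B} → f ∼ g → g ∼ h → f ∼ h
    ⨾-resp  : ∀ {A B E} {f f' : Hom A B} {g g' : Hom B E} →
              f ∼ f' → g ∼ g' → f ⨾ g ∼ f' ⨾ g'
    ⊗-resp  : ∀ {A B A' B'} {f f' : Hom A B} {g g' : Hom A' B'} →
              f ∼ f' → g ∼ g' → f ⊗₁ g ∼ f' ⊗₁ g'
    tr-resp : ∀ {S T X Y} {f : Hom (S ⊗₀ X) (S ⊗₀ Y)} {g : Hom (T ⊗₀ X) (T ⊗₀ Y)}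
              {u v : Hom S T} →
              u ∼ v → f ⨾ (u ⊗₁ id) ∼ (v ⊗₁ id) ⨾ g → tr S f ∼ tr T g

Unif : ∀ {ℓ} → TSMC ℓ → TSMC ℓ
Unif C = record
  { category = record
      { Obj = Obj ; Hom = Hom ; _≈_ = _∼_ C
      ; ≈-equiv = record { refl = base ≈-refl ; sym = ∼-sym ; trans = ∼-trans }
      ; id = id ; _⨾_ = _⨾_ ; ⨾-cong = ⨾-resp
      ; identityˡ = base identityˡ ; identityʳ = base identityʳ ; assoc = base assoc }
  ; I = I ; _⊗₀_ = _⊗₀_ ; ⊗₀-assoc = ⊗₀-assoc ; ⊗₀-unitˡ = ⊗₀-unitˡ ; ⊗₀-unitʳ = ⊗₀-unitʳ
  ; _⊗₁_ = _⊗₁_ ; ⊗₁-cong = ⊗-resp ; ⊗-id = base ⊗-id ; ⊗-⨾ = base ⊗-⨾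
  ; ⊗-assoc = base ⊗-assoc ; ⊗-unitˡ = base ⊗-unitˡ ; ⊗-unitʳ = base ⊗-unitʳ
  ; σ = σ ; σ-natural = base σ-natural ; σ-involutive = λ A B → base (σ-involutive A B)
  ; σ-hexagon = λ A B E → base (σ-hexagon A B E)
  ; tr = tr
  ; tr-cong = λ e → tr-resp (base ≈-refl)
      (∼-trans (⨾-resp e (base ⊗-id))
        (∼-trans (base identityʳ) (base (≈-sym (≈-trans (⨾-cong ⊗-id ≈-refl) identityˡ)))))
  ; tightening = λ u f v → base (tightening u f v)
  ; strength = λ f g → base (strength f g)
  ; joining = λ f → base (joining f)
  ; vanishing = λ f → base (vanishing f)
  ; sliding = λ f u → base (sliding f u)
  ; yanking = λ S → base (yanking S)
  }
  where open TSMC C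

UnifU : ∀ {ℓ} → TSMC ℓ → UTSMC ℓ
UnifU C = record { tsmc = Unif C ; uniform = λ f g r e → tr-resp (base ≈-refl) e }
  where open TSMC C

-- F preserves the relations:  f ≈_B g  implies  F f ≈_C F g
-- (this is exactly what is needed for  Unif(F)[f] = [F f]  to be well defined)
PreservesUnif : ∀ {ℓ} {B C : TSMC ℓ} → B ⇒ C → Set ℓ
PreservesUnif {B = B} {C} F =
  ∀ {A A'} {f g : TSMC.Hom B A A'} → _∼_ B f g → _∼_ C (F₁ F f) (F₁ F g)

UnifF : ∀ {ℓ} {B C : TSMC ℓ} (F : B ⇒ C) → PreservesUnif F → Unif B ⇒ Unif C
UnifF F wd = record
  { F₀ = F₀ F ; F₁ = F₁ F ; F-cong = wd
  ; F-id = base (F-id F) ; F-⨾ = base (F-⨾ F) ; F-I = F-I F ; F-⊗₀ = F-⊗₀ F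
  ; F-⊗₁ = base (F-⊗₁ F) ; F-σ = λ A B → base (F-σ F A B) ; F-tr = λ S f → base (F-tr F S f) }

-- Unif is a functor TSMC → UTSMC (UTSMC is a full subcategory, so its
-- morphisms are those of TSMC between the underlying categories).
UnifIsFunctor : ∀ {ℓ} → (∀ {B C : TSMC ℓ} (F : B ⇒ C) → PreservesUnif F) → Set (lsuc ℓ)
UnifIsFunctor {ℓ} wd =
  (∀ (B : TSMC ℓ) → UnifF (idF {C = B}) (wd idF) ≐ idF {C = Unif B}) ×
  (∀ {A B C : TSMC ℓ} (F : A ⇒ B) (G : B ⇒ C) →
     UnifF (F ⨾F G) (wd (F ⨾F G)) ≐ UnifF F (wd F) ⨾F UnifF G (wd G))

-- Unif ⊣ ι, expressed by a unit  η_C : C → ι(Unif C)  that is natural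
-- (w.r.t. Unif on morphisms) and universal: every F : C → ι D with D
-- uniformly traced factors as  η_C ⨾ G  for a unique  G : Unif C → D.
UnifLeftAdjoint : ∀ {ℓ} → (∀ {B C : TSMC ℓ} (F : B ⇒ C) → PreservesUnif F) → Set (lsuc ℓ)
UnifLeftAdjoint {ℓ} wd =
  Σ[ η ∈ (∀ (C : TSMC ℓ) → C ⇒ ι (UnifU C)) ]
    (∀ {B C : TSMC ℓ} (F : B ⇒ C) → (η B ⨾F UnifF F (wd F)) ≐ (F ⨾F η C)) ×
    (∀ (C : TSMC ℓ) (D : UTSMC ℓ) (F : C ⇒ ι D) →
       Σ[ G ∈ (ι (UnifU C) ⇒ ι D) ]
         ((η C ⨾F G) ≐ F) × (∀ (G' : ι (UnifU C) ⇒ ι D) → (η C ⨾F G') ≐ F → G' ≐ G))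

{-# OPTIONS --safe #-}
module Submission where

-- Uniformity is the only closure rule of ∼ that is not an equation of the
-- traced structure itself, and a trace-preserving strict symmetric monoidal
-- functor carries a commuting square  f ⨾ (u ⊗ id) = (v ⊗ id) ⨾ g  to one of
-- the same shape.  So by induction on ∼, every such functor into a uniformly
-- traced category sends ∼-related morphisms to equal ones, i.e. factors
-- through the quotient  C → Unif(C),  uniquely since that quotient is the
-- identity on objects and surjective on morphisms.  Applied to  F ⨾ (C → Unif C)  this also makes Unif well defined
-- on morphisms; functoriality and naturality then hold on the nose.

open import Defs
open import Level using (Level)
open import Data.Product using (_×_; Σ-syntax; _,_)
open import Relation.Binary using (Setoid)
open import Relation.Binary.PropositionalEquality as P using (_≡_; refl)
import Relation.Binary.Reasoning.Setoid as SetoidReasoning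

module CategoryProperties {ℓ} (C : Category ℓ) where
  open Category C

  hom-setoid : Obj → Obj → Setoid ℓ ℓ
  hom-setoid A B = record { isEquivalence = ≈-equiv {A} {B} }

  module HomReasoning {A B : Obj} = SetoidReasoning (hom-setoid A B)

  id⨾f⨾id≈f : ∀ {A B} {f : Hom A B} → id ⨾ f ⨾ id ≈ f
  id⨾f⨾id≈f = ≈-trans identityˡ identityʳ

  transport : ∀ {A A' B B'} → A ≡ A' → B ≡ B' → Hom A B → Hom A' B'
  transport p q f = cast (P.sym p) ⨾ f ⨾ cast q

  transport-cong : ∀ {A A' B B'} (p : A ≡ A') (q : B ≡ B') {f g : Hom A B} →
                   f ≈ g → transport p q f ≈ transport p q g
  transport-cong _ _ f≈g = ⨾-cong ≈-refl (⨾-cong f≈g ≈-refl)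

  transport-⨾ : ∀ {A A' B B' E E'} (p : A ≡ A') (q : B ≡ B') (r : E ≡ E')
                {f : Hom A B} {g : Hom B E} →
                transport p r (f ⨾ g) ≈ transport p q f ⨾ transport q r g
  transport-⨾ refl refl refl =
    ≈-trans id⨾f⨾id≈f (≈-sym (⨾-cong id⨾f⨾id≈f id⨾f⨾id≈f))

  transport-inverse : ∀ {A A' B B'} (p : A ≡ A') (q : B ≡ B') {f : Hom A B} {g : Hom A' B'} →
                      f ≈ cast p ⨾ g ⨾ cast (P.sym q) → transport p q f ≈ g
  transport-inverse refl refl f≈g = ≈-trans id⨾f⨾id≈f (≈-trans f≈g id⨾f⨾id≈f)

module FunctorProperties {ℓ} {B D : TSMC ℓ} (F : B ⇒ D) where
  private module B = TSMC B
  open TSMC D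
  open CategoryProperties category

  -- F₁ read between tensor products of images: the form in which F-tr is stated.
  F₁⊗ : ∀ {S X T Y} → B.Hom (S B.⊗₀ X) (T B.⊗₀ Y) → Hom (F₀ F S ⊗₀ F₀ F X) (F₀ F T ⊗₀ F₀ F Y)
  F₁⊗ {S} {X} {T} {Y} h = transport (F-⊗₀ F S X) (F-⊗₀ F T Y) (F₁ F h)

  F₁⊗-⨾ : ∀ {S X T Y U Z} {h : B.Hom (S B.⊗₀ X) (T B.⊗₀ Y)} {k : B.Hom (T B.⊗₀ Y) (U B.⊗₀ Z)} →
          F₁⊗ (h B.⨾ k) ≈ F₁⊗ h ⨾ F₁⊗ k
  F₁⊗-⨾ = ≈-trans (transport-cong _ _ (F-⨾ F)) (transport-⨾ _ _ _)

  F₁⊗-⊗-id : ∀ {S T Y} {u : B.Hom S T} → F₁⊗ (u B.⊗₁ B.id {Y}) ≈ F₁ F u ⊗₁ id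
  F₁⊗-⊗-id = transport-inverse _ _
    (≈-trans (F-⊗₁ F) (⨾-cong ≈-refl (⨾-cong (⊗₁-cong ≈-refl (F-id F)) ≈-refl)))

  F-preserves-uniformity-square :
    ∀ {S T X Y} {f : B.Hom (S B.⊗₀ X) (S B.⊗₀ Y)} {g : B.Hom (T B.⊗₀ X) (T B.⊗₀ Y)} {u v : B.Hom S T} →
    F₁ F (f B.⨾ (u B.⊗₁ B.id)) ≈ F₁ F ((v B.⊗₁ B.id) B.⨾ g) →
    F₁⊗ f ⨾ (F₁ F u ⊗₁ id) ≈ (F₁ F v ⊗₁ id) ⨾ F₁⊗ g
  F-preserves-uniformity-square {f = f} {g} {u} {v} square = begin
    F₁⊗ f ⨾ (F₁ F u ⊗₁ id)           ≈⟨ ⨾-cong ≈-refl F₁⊗-⊗-id ⟨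
    F₁⊗ f ⨾ F₁⊗ (u B.⊗₁ B.id)        ≈⟨ F₁⊗-⨾ ⟨
    F₁⊗ (f B.⨾ (u B.⊗₁ B.id))        ≈⟨ transport-cong _ _ square ⟩
    F₁⊗ ((v B.⊗₁ B.id) B.⨾ g)        ≈⟨ F₁⊗-⨾ ⟩
    F₁⊗ (v B.⊗₁ B.id) ⨾ F₁⊗ g        ≈⟨ ⨾-cong F₁⊗-⊗-id ≈-refl ⟩
    (F₁ F v ⊗₁ id) ⨾ F₁⊗ g           ∎
    where open HomReasoning

F₁-resp-∼ : ∀ {ℓ} {B D : TSMC ℓ} → IsUniform D → (F : B ⇒ D) →
            ∀ {A A'} {f g : TSMC.Hom B A A'} → _∼_ B f g → TSMC._≈_ D (F₁ F f) (F₁ F g)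
F₁-resp-∼ {B = B} {D} uniform F = resp
  where
  open TSMC D
  open FunctorProperties F

  resp : ∀ {A A'} {f g : TSMC.Hom B A A'} → _∼_ B f g → F₁ F f ≈ F₁ F g
  resp (base f≈g) = F-cong F f≈g
  resp (∼-sym g∼f) = ≈-sym (resp g∼f)
  resp (∼-trans f∼h h∼g) = ≈-trans (resp f∼h) (resp h∼g)
  resp (⨾-resp f∼f' g∼g') =
    ≈-trans (F-⨾ F) (≈-trans (⨾-cong (resp f∼f') (resp g∼g')) (≈-sym (F-⨾ F)))
  resp (⊗-resp f∼f' g∼g') =
    ≈-trans (F-⊗₁ F)
      (≈-trans (⨾-cong ≈-refl (⨾-cong (⊗₁-cong (resp f∼f') (resp g∼g')) ≈-refl))
        (≈-sym (F-⊗₁ F)))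
  resp (tr-resp {S} {T} {X} {Y} {f} {g} {u} u∼v square) =
    ≈-trans (F-tr F S f)
      (≈-trans (uniform _ _ (F₁ F u) image-square) (≈-sym (F-tr F T g)))
    where
    image-square : F₁⊗ f ⨾ (F₁ F u ⊗₁ id {F₀ F Y}) ≈ (F₁ F u ⊗₁ id {F₀ F X}) ⨾ F₁⊗ g
    image-square = ≈-trans (F-preserves-uniformity-square (resp square))
                           (⨾-cong (⊗₁-cong (≈-sym (resp u∼v)) ≈-refl) ≈-refl)

η : ∀ {ℓ} (C : TSMC ℓ) → C ⇒ ι (UnifU C)
η C = record
  { F₀ = λ A → A ; F₁ = λ f → f ; F-cong = base ; F-id = base ≈-refl ; F-⨾ = base ≈-refl
  ; F-I = refl ; F-⊗₀ = λ _ _ → refl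
  ; F-⊗₁ = base (≈-sym id⨾f⨾id≈f) ; F-σ = λ _ _ → base (≈-sym id⨾f⨾id≈f)
  ; F-tr = λ _ _ → base (tr-cong (≈-sym id⨾f⨾id≈f)) }
  where
  open TSMC C
  open CategoryProperties category

extend : ∀ {ℓ} {C : TSMC ℓ} (D : UTSMC ℓ) → C ⇒ ι D → ι (UnifU C) ⇒ ι D
extend D F = record
  { F₀ = F₀ F ; F₁ = F₁ F ; F-cong = F₁-resp-∼ (UTSMC.uniform D) F
  ; F-id = F-id F ; F-⨾ = F-⨾ F ; F-I = F-I F ; F-⊗₀ = F-⊗₀ F
  ; F-⊗₁ = F-⊗₁ F ; F-σ = F-σ F ; F-tr = F-tr F }

preservesUnif : ∀ {ℓ} {B C : TSMC ℓ} (F : B ⇒ C) → PreservesUnif F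
preservesUnif {C = C} F = F₁-resp-∼ (UTSMC.uniform (UnifU C)) (F ⨾F η C)

module _ {ℓ : Level} where
  private
    id⨾f⨾id≈f : (D : TSMC ℓ) {A B : TSMC.Obj D} {f : TSMC.Hom D A B} →
                TSMC._≈_ D (TSMC._⨾_ D (TSMC.id D) (TSMC._⨾_ D f (TSMC.id D))) f
    id⨾f⨾id≈f D = CategoryProperties.id⨾f⨾id≈f (TSMC.category D)

  Unif-identity : (B : TSMC ℓ) → UnifF (idF {C = B}) (preservesUnif idF) ≐ idF
  Unif-identity B = record { eq₀ = λ _ → refl ; eq₁ = λ _ → id⨾f⨾id≈f (Unif B) }

  Unif-homomorphism : {A B C : TSMC ℓ} (F : A ⇒ B) (G : B ⇒ C) →
    UnifF (F ⨾F G) (preservesUnif (F ⨾F G)) ≐ UnifF F (preservesUnif F) ⨾F UnifF G (preservesUnif G)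
  Unif-homomorphism {C = C} _ _ = record { eq₀ = λ _ → refl ; eq₁ = λ _ → id⨾f⨾id≈f (Unif C) }

  η-natural : {B C : TSMC ℓ} (F : B ⇒ C) → (η B ⨾F UnifF F (preservesUnif F)) ≐ (F ⨾F η C)
  η-natural {C = C} _ = record { eq₀ = λ _ → refl ; eq₁ = λ _ → id⨾f⨾id≈f (Unif C) }

  extend-factors : {C : TSMC ℓ} (D : UTSMC ℓ) (F : C ⇒ ι D) → (η C ⨾F extend D F) ≐ F
  extend-factors D _ = record { eq₀ = λ _ → refl ; eq₁ = λ _ → id⨾f⨾id≈f (ι D) }

  extend-unique : {C : TSMC ℓ} (D : UTSMC ℓ) (F : C ⇒ ι D) (G : ι (UnifU C) ⇒ ι D) →
                  (η C ⨾F G) ≐ F → G ≐ extend D F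
  extend-unique _ _ _ η⨾G≐F = record { eq₀ = _≐_.eq₀ η⨾G≐F ; eq₁ = _≐_.eq₁ η⨾G≐F }

proposition4p6 : ∀ {ℓ : Level} →
    Σ[ wd ∈ (∀ {B C : TSMC ℓ} (F : B ⇒ C) → PreservesUnif F) ]
      (UnifIsFunctor wd × UnifLeftAdjoint wd)
proposition4p6 =
  preservesUnif ,
  (Unif-identity , Unif-homomorphism) ,
  η , η-natural ,
  λ C D F → extend D F , extend-factors D F , extend-unique D F
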